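{- There are $n$-vertex graphs that need $\Omega(n)$ colors in any improper strong odd coloring; that is, there exist a constant $c>0$ and, for arbitrarily large $n$, graphs $G$ on $n$ vertices such that every improper strong odd coloring of $G$ uses at least $cn$ colors.
   Context: All graphs are finite and simple. An \emph{improper strong odd coloring} of a graph $G$ is a vertex-coloring $\varphi\colon V(G)\to[t]$ (not required to be proper) such that for every vertex $v\in V(G)$ and every color $i\in[t]$ the number $|N(v)\cap\varphi^{ -1}(i)|$ is either zero or odd. -}

module Defs where

open import Data.Bool using (Bool; true; false; if_then_else_; _∧_)
open import Data.Nat using (ℕ; zero; suc; _+_; _%_)
open import Data.Fin using (Fin; zero; suc; _≟_)
open import Data.Fin.Properties using (any?)
open import Data.Product using (Σ; _,_)
open import Data.Sum using (_⊎_)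
open import Relation.Nullary.Decidable using (⌊_⌋)
open import Relation.Binary.PropositionalEquality using (_≡_)

record Graph (n : ℕ) : Set where
  field
    adj   : Fin n → Fin n → Bool
    sym   : ∀ u v → adj u v ≡ adj v u
    irrefl : ∀ v → adj v v ≡ false
open Graph public

count : {n : ℕ} → (Fin n → Bool) → ℕ
count {zero}  f = 0
count {suc n} f = (if f zero then 1 else 0) + count (λ x → f (suc x))

nbrsColored : {n t : ℕ} → Graph n → (Fin n → Fin t) → Fin n → Fin t → ℕ
nbrsColored G φ v i = count (λ u → adj G v u ∧ ⌊ φ u ≟ i ⌋)

ZeroOrOdd : ℕ → Set
ZeroOrOdd k = k ≡ 0 ⊎ k % 2 ≡ 1

IsImproperStrongOddColoring : {n t : ℕ} → Graph n → (Fin n → Fin t) → Set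
IsImproperStrongOddColoring G φ = ∀ v i → ZeroOrOdd (nbrsColored G φ v i)

colorsUsed : {n t : ℕ} → (Fin n → Fin t) → ℕ
colorsUsed φ = count (λ i → ⌊ any? (λ u → φ u ≟ i) ⌋)

-- In the complete graph Kₙ the neighbours of v of colour i are the whole colour class of i,
-- minus v itself when v has colour i. So in an improper strong odd colouring of Kₙ with n odd,
-- every non-empty colour class has odd size: either it misses some vertex w, whose neighbours of
-- that colour are the entire class, or it is all of V(Kₙ). If two vertices shared a colour, one
-- of them would see an odd, non-zero number of neighbours of that colour, namely the class size
-- minus one, which would then be even. Hence the colouring is injective and uses n colours.
module Submission where

open import Defs
open import Data.Bool using (Bool; true; false; not; _∧_; if_then_else_)
open import Data.Fin using (Fin; zero; suc; _≟_)
open import Data.Fin.Properties using (any?; 0≢1+n; suc-injective)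
open import Data.Nat using (ℕ; zero; suc; _+_; _*_; _%_; _≤_; _<_; _>_; z≤n; s≤s)
open import Data.Nat.DivMod using ([m+kn]%n≡m%n)
open import Data.Nat.Properties
  using (+-comm; +-assoc; +-identityʳ; *-identityˡ; ≤-trans; m≤n+m; m≤m*n; n≤1+n; module ≤-Reasoning)
open import Data.Product using (Σ; _×_; _,_)
open import Data.Sum using (inj₁; inj₂)
open import Function using (_∘_)
open import Function.Definitions using (Injective)
open import Relation.Binary.PropositionalEquality
  using (_≡_; _≢_; refl; trans; cong; cong₂; subst; subst₂; module ≡-Reasoning)
  renaming (sym to ≡-sym)
open import Relation.Nullary using (¬_; Dec; yes; no; contradiction)
open import Relation.Nullary.Decidable using (⌊_⌋; ¬?; isYes≗does; dec-true; dec-false; decidable-stable)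

⌊⌋-true : ∀ {a} {A : Set a} (a? : Dec A) → A → ⌊ a? ⌋ ≡ true
⌊⌋-true a? a = trans (isYes≗does a?) (dec-true a? a)

⌊⌋-false : ∀ {a} {A : Set a} (a? : Dec A) → ¬ A → ⌊ a? ⌋ ≡ false
⌊⌋-false a? ¬a = trans (isYes≗does a?) (dec-false a? ¬a)

boolToℕ : Bool → ℕ
boolToℕ b = if b then 1 else 0

_≢ᵇ_ : ∀ {n} → Fin n → Fin n → Bool
u ≢ᵇ v = not ⌊ u ≟ v ⌋

≢ᵇ-sym : ∀ {n} (u v : Fin n) → u ≢ᵇ v ≡ v ≢ᵇ u
≢ᵇ-sym u v with u ≟ v | v ≟ u
... | yes _   | yes _   = refl
... | no _    | no _    = refl
... | yes u≡v | no v≢u  = contradiction (≡-sym u≡v) v≢u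
... | no u≢v  | yes v≡u = contradiction (≡-sym v≡u) u≢v

≢ᵇ-irrefl : ∀ {n} (v : Fin n) → v ≢ᵇ v ≡ false
≢ᵇ-irrefl v = cong not (⌊⌋-true (v ≟ v) refl)

≢ᵇ-suc : ∀ {n} (u v : Fin n) → suc u ≢ᵇ suc v ≡ u ≢ᵇ v
≢ᵇ-suc u v with u ≟ v
... | yes _ = refl
... | no _  = refl

complete : ∀ n → Graph n
complete n = record { adj = _≢ᵇ_ ; sym = ≢ᵇ-sym ; irrefl = ≢ᵇ-irrefl }

count-cong : ∀ {n} {f g : Fin n → Bool} → (∀ x → f x ≡ g x) → count f ≡ count g
count-cong {zero}  f≗g = refl
count-cong {suc n} f≗g rewrite f≗g zero = cong (_ +_) (count-cong (f≗g ∘ suc))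

count-pos : ∀ {n} (f : Fin n → Bool) {x : Fin n} → f x ≡ true → 0 < count f
count-pos f {zero}  fx≡true rewrite fx≡true = s≤s z≤n
count-pos f {suc x} fx≡true = ≤-trans (count-pos (f ∘ suc) fx≡true) (m≤n+m _ _)

count-all : ∀ {n} (f : Fin n → Bool) → (∀ x → f x ≡ true) → count f ≡ n
count-all {zero}  f all = refl
count-all {suc n} f all rewrite all zero = cong suc (count-all (f ∘ suc) (all ∘ suc))

count-without : ∀ {n} (f : Fin n → Bool) (w : Fin n) →
  count (λ u → w ≢ᵇ u ∧ f u) + boolToℕ (f w) ≡ count f
count-without {suc n} f zero = +-comm (count (f ∘ suc)) (boolToℕ (f zero))
count-without {suc n} f (suc w) = begin
    boolToℕ (f zero) + count (λ u → suc w ≢ᵇ suc u ∧ f (suc u)) + boolToℕ (f (suc w))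
  ≡⟨ +-assoc (boolToℕ (f zero)) _ _ ⟩
    boolToℕ (f zero) + (count (λ u → suc w ≢ᵇ suc u ∧ f (suc u)) + boolToℕ (f (suc w)))
  ≡⟨ cong (λ k → boolToℕ (f zero) + (k + boolToℕ (f (suc w))))
          (count-cong (λ u → cong (_∧ f (suc u)) (≢ᵇ-suc w u))) ⟩
    boolToℕ (f zero) + (count (λ u → w ≢ᵇ u ∧ f (suc u)) + boolToℕ (f (suc w)))
  ≡⟨ cong (boolToℕ (f zero) +_) (count-without (f ∘ suc) w) ⟩
    boolToℕ (f zero) + count (f ∘ suc)
  ∎
  where open ≡-Reasoning

count-injective-≥ : ∀ {n t} (f : Fin t → Bool) {h : Fin n → Fin t} →
  Injective _≡_ _≡_ h → (∀ x → f (h x) ≡ true) → n ≤ count f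
count-injective-≥ {zero}  f h-inj fh = z≤n
count-injective-≥ {suc n} f {h} h-inj fh = begin
    suc n                           ≤⟨ s≤s (count-injective-≥ f′ (suc-injective ∘ h-inj) f′h) ⟩
    suc (count f′)                  ≡⟨ +-comm 1 (count f′) ⟩
    count f′ + boolToℕ true         ≡⟨ cong (λ b → count f′ + boolToℕ b) (≡-sym (fh zero)) ⟩
    count f′ + boolToℕ (f (h zero)) ≡⟨ count-without f (h zero) ⟩
    count f                         ∎
  where
  open ≤-Reasoning
  f′ : Fin _ → Bool
  f′ u = h zero ≢ᵇ u ∧ f u
  f′h : ∀ x → f′ (h (suc x)) ≡ true
  f′h x rewrite ⌊⌋-false (h zero ≟ h (suc x)) (0≢1+n ∘ h-inj) | fh (suc x) = refl

colorsUsed-injective : ∀ {n t} {φ : Fin n → Fin t} → Injective _≡_ _≡_ φ → n ≤ colorsUsed φ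
colorsUsed-injective {φ = φ} φ-inj =
  count-injective-≥ _ φ-inj (λ x → ⌊⌋-true (any? (λ u → φ u ≟ φ x)) (x , refl))

ZeroOrOdd-pos⇒odd : ∀ {k} → ZeroOrOdd k → 0 < k → k % 2 ≡ 1
ZeroOrOdd-pos⇒odd (inj₁ refl) ()
ZeroOrOdd-pos⇒odd (inj₂ odd)  _ = odd

odd⇒suc-not-odd : ∀ k → k % 2 ≡ 1 → suc k % 2 ≢ 1
odd⇒suc-not-odd (suc zero)    _   ()
odd⇒suc-not-odd (suc (suc k)) odd = odd⇒suc-not-odd k odd

colorClassSize : ∀ {n t} → (Fin n → Fin t) → Fin t → ℕ
colorClassSize φ i = count (λ u → ⌊ φ u ≟ i ⌋)

module OddCompleteGraph {n t : ℕ} (n-odd : n % 2 ≡ 1) {φ : Fin n → Fin t}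
                        (φ-odd : IsImproperStrongOddColoring (complete n) φ) where

  nbrs : Fin n → Fin t → ℕ
  nbrs = nbrsColored (complete n) φ

  nbrs+self≡class : ∀ v i → nbrs v i + boolToℕ ⌊ φ v ≟ i ⌋ ≡ colorClassSize φ i
  nbrs+self≡class v i = count-without (λ u → ⌊ φ u ≟ i ⌋) v

  nbrs≡class : ∀ {v i} → φ v ≢ i → nbrs v i ≡ colorClassSize φ i
  nbrs≡class {v} {i} φv≢i = begin
    nbrs v i                               ≡⟨ ≡-sym (+-identityʳ _) ⟩
    nbrs v i + boolToℕ false               ≡⟨ cong (λ b → nbrs v i + boolToℕ b) (≡-sym (⌊⌋-false (φ v ≟ i) φv≢i)) ⟩
    nbrs v i + boolToℕ ⌊ φ v ≟ i ⌋         ≡⟨ nbrs+self≡class v i ⟩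
    colorClassSize φ i                     ∎
    where open ≡-Reasoning

  class≡suc-nbrs : ∀ v → colorClassSize φ (φ v) ≡ suc (nbrs v (φ v))
  class≡suc-nbrs v = begin
    colorClassSize φ (φ v)                 ≡⟨ ≡-sym (nbrs+self≡class v (φ v)) ⟩
    nbrs v (φ v) + boolToℕ ⌊ φ v ≟ φ v ⌋   ≡⟨ cong (λ b → nbrs v (φ v) + boolToℕ b) (⌊⌋-true (φ v ≟ φ v) refl) ⟩
    nbrs v (φ v) + 1                       ≡⟨ +-comm _ 1 ⟩
    suc (nbrs v (φ v))                     ∎
    where open ≡-Reasoning

  colorClassSize-odd : ∀ i → 0 < colorClassSize φ i → colorClassSize φ i % 2 ≡ 1
  colorClassSize-odd i class-pos with any? (λ w → ¬? (φ w ≟ i))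
  ... | yes (w , φw≢i) = ZeroOrOdd-pos⇒odd (subst ZeroOrOdd (nbrs≡class φw≢i) (φ-odd w i)) class-pos
  ... | no everyone-i  = subst (λ k → k % 2 ≡ 1) (≡-sym (count-all _ in-class)) n-odd
    where
    in-class : ∀ u → ⌊ φ u ≟ i ⌋ ≡ true
    in-class u = ⌊⌋-true (φ u ≟ i) (decidable-stable (φ u ≟ i) (λ φu≢i → everyone-i (u , φu≢i)))

  injective : Injective _≡_ _≡_ φ
  injective {a} {b} φa≡φb with a ≟ b
  ... | yes a≡b = a≡b
  ... | no  a≢b = contradiction
                    (subst (λ k → k % 2 ≡ 1) (class≡suc-nbrs a) (colorClassSize-odd (φ a) class-pos))
                    (odd⇒suc-not-odd (nbrs a (φ a)) nbrs-odd)
    where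
    nbrs-pos : 0 < nbrs a (φ a)
    nbrs-pos = count-pos _ {b}
      (cong₂ _∧_ (cong not (⌊⌋-false (a ≟ b) a≢b)) (⌊⌋-true (φ b ≟ φ a) (≡-sym φa≡φb)))
    nbrs-odd : nbrs a (φ a) % 2 ≡ 1
    nbrs-odd = ZeroOrOdd-pos⇒odd (φ-odd a (φ a)) nbrs-pos
    class-pos : 0 < colorClassSize φ (φ a)
    class-pos = subst (0 <_) (≡-sym (class≡suc-nbrs a)) (s≤s z≤n)

proposition19 : Σ ℕ λ p → Σ ℕ λ q → (p > 0 × q > 0) ×
    ((N : ℕ) → Σ ℕ λ n → (N ≤ n) × Σ (Graph n) λ G →
    (t : ℕ) (φ : Fin n → Fin t) → IsImproperStrongOddColoring G φ →
    p * n ≤ q * colorsUsed φ)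
proposition19 = 1 , 1 , (s≤s z≤n , s≤s z≤n) , λ N →
  1 + N * 2 , ≤-trans (m≤m*n N 2) (n≤1+n _) , complete (1 + N * 2) ,
  λ t φ φ-odd → subst₂ _≤_ (≡-sym (*-identityˡ _)) (≡-sym (*-identityˡ _))
    (colorsUsed-injective (OddCompleteGraph.injective ([m+kn]%n≡m%n 1 N 2) φ-odd))
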